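{- For $k\ge 3$, the $k$-prism has injective chromatic number $4$ if and only if $k\not\equiv 0\pmod 3$.
   Context: The $k$-prism ($k\ge 3$) is the graph consisting of two $k$-cycles $u_0u_1\cdots u_{k-1}$ and $v_0v_1\cdots v_{k-1}$ together with the edges $u_iv_i$ for $0\le i\le k-1$. An injective $k$-colouring of a graph $G$ is a map $c:V(G)\to\{1,\dots,k\}$ such that any two distinct vertices with a common neighbour get different colours; the injective chromatic number $\chi_i(G)$ is the least such $k$. -}

module Defs where

open import Data.Nat using (ℕ; suc; _<_; _%_; NonZero)
open import Data.Fin using (Fin; toℕ)
open import Data.Product using (_×_; _,_; Σ; ∃)
open import Data.Sum using (_⊎_)
open import Relation.Nullary using (¬_)
open import Relation.Binary.PropositionalEquality using (_≡_; _≢_)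
open import Level using (0ℓ)

record Graph : Set₁ where
  field
    V   : Set
    Adj : V → V → Set

open Graph public

-- Injective m-colouring: c : V → Fin m (colours 1..m rendered as Fin m) such that
-- any two distinct vertices with a common neighbour receive different colours.
IsInjectiveColouring : (G : Graph) (m : ℕ) → (V G → Fin m) → Set
IsInjectiveColouring G m c =
  ∀ (x y w : V G) → x ≢ y → Adj G x w → Adj G y w → c x ≢ c y

InjectivelyColourable : Graph → ℕ → Set
InjectivelyColourable G m = Σ (V G → Fin m) (IsInjectiveColouring G m)

InjChromaticNumber : Graph → ℕ → Set
InjChromaticNumber G m =
  InjectivelyColourable G m × (∀ j → j < m → ¬ InjectivelyColourable G j)

CycAdj : (k : ℕ) → .{{NonZero k}} → Fin k → Fin k → Set
CycAdj k i j = (toℕ j ≡ suc (toℕ i) % k) ⊎ (toℕ i ≡ suc (toℕ j) % k)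

-- The k-prism: vertices (0,i) = u_i and (1,i) = v_i.
-- Edges: u_i u_{i+1}, v_i v_{i+1} (indices mod k), and u_i v_i.
PrismAdj : (k : ℕ) → .{{NonZero k}} → Fin 2 × Fin k → Fin 2 × Fin k → Set
PrismAdj k (s , i) (t , j) = (s ≡ t × CycAdj k i j) ⊎ (s ≢ t × i ≡ j)

Prism : (k : ℕ) → .{{NonZero k}} → Graph
Prism k = record { V = Fin 2 × Fin k ; Adj = PrismAdj k }

{-# OPTIONS --safe #-}
module Submission where

open import Defs
open import Data.Nat using (ℕ; zero; suc; pred; _+_; _*_; _≤_; _<_; _%_; _/_; z≤n; s≤s; NonZero)
open import Data.Nat.Properties
  using (≤-refl; ≤-trans; ≤-pred; +-assoc; +-comm; *-comm; +-mono-≤-<; +-cancelʳ-<; ≮⇒≥; _<?_; m≤n⇒∃[o]m+o≡n; m≤n⇒m<n∨m≡n; suc-pred)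
open import Data.Nat.DivMod
  using (_mod_; m%n<n; m<n⇒m%n≡m; m≡m%n+[m/n]*n; %-distribˡ-+; m%n%n≡m%n; [m+kn]%n≡m%n; %-remove-+ˡ)
open import Data.Nat.Divisibility using (∣-refl; n∣m*n; m%n≡0⇒n∣m)
open import Data.Nat.Tactic.RingSolver using (solve-∀)
open import Data.Fin using (Fin; toℕ; opposite)
open import Data.Fin.Patterns using (0F; 1F; 2F; 3F)
open import Data.Fin.Properties using (toℕ-injective; toℕ-fromℕ<; toℕ<n; punchOut-injective)
open import Data.Product using (_×_; _,_; proj₁; proj₂; ∃; ∃₂)
open import Data.Sum using (inj₁; inj₂)
open import Function using (_∘_)
open import Function.Bundles using (_⇔_; mk⇔)
open import Relation.Nullary using (¬_; contradiction; yes; no)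
open import Relation.Binary.PropositionalEquality
  using (_≡_; _≢_; refl; sym; trans; cong; subst; subst₂; module ≡-Reasoning)
open ≡-Reasoning

-- A colouring of the prism is injective exactly when the three neighbours of every vertex get
-- three different colours.  With three colours, v (i + 1) must get the colour missing from u i
-- and u (i + 2); comparing this at i and i + 2 shows that the colours along the u-cycle have
-- period 6 and differ at i, i + 2 and i + 4.  Walking twice around the cycle (2k steps) returns
-- to the same vertex, so 3 divides k.  Conversely, giving both cycles one sequence in which any
-- three cyclically consecutive terms differ is an injective colouring: i mod 3 when 3 divides k,
-- and with four colours a concatenation of t blocks 012 and b blocks 0123 when k = 3t + 4b.
-- This covers every k not divisible by 3 except k = 5, where the two cycles are coloured
-- differently by hand.

Distinct₃ : {A : Set} → A → A → A → Set
Distinct₃ a b c = a ≢ b × a ≢ c × b ≢ c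

Distinct₃-≡ : {A : Set} {a a′ b b′ c c′ : A} →
  a ≡ a′ → b ≡ b′ → c ≡ c′ → Distinct₃ a′ b′ c′ → Distinct₃ a b c
Distinct₃-≡ refl refl refl d = d

Fin2-≢⇒≡ : {x y z : Fin 2} → x ≢ z → y ≢ z → x ≡ y
Fin2-≢⇒≡ {0F} {0F} _   _   = refl
Fin2-≢⇒≡ {1F} {1F} _   _   = refl
Fin2-≢⇒≡ {0F} {1F} {0F} x≢z _   = contradiction refl x≢z
Fin2-≢⇒≡ {0F} {1F} {1F} _   y≢z = contradiction refl y≢z
Fin2-≢⇒≡ {1F} {0F} {0F} _   y≢z = contradiction refl y≢z
Fin2-≢⇒≡ {1F} {0F} {1F} x≢z _   = contradiction refl x≢z

-- Deleting a from Fin 3 leaves a copy of Fin 2 in which x and y both avoid b.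
Fin3-≢⇒≡ : {a b x y : Fin 3} → a ≢ b → x ≢ a → x ≢ b → y ≢ a → y ≢ b → x ≡ y
Fin3-≢⇒≡ {a} {b} {x} {y} a≢b x≢a x≢b y≢a y≢b =
  punchOut-injective a≢x a≢y (Fin2-≢⇒≡ (x≢b ∘ punchOut-injective a≢x a≢b) (y≢b ∘ punchOut-injective a≢y a≢b))
  where
  a≢x : a ≢ x
  a≢x = x≢a ∘ sym
  a≢y : a ≢ y
  a≢y = y≢a ∘ sym

Fin≤2-¬Distinct₃ : ∀ {j} → j ≤ 2 → (a b c : Fin j) → ¬ Distinct₃ a b c
Fin≤2-¬Distinct₃ {1} _ 0F 0F _ (a≢b , _) = a≢b refl
Fin≤2-¬Distinct₃ {2} _ a b c (a≢b , a≢c , b≢x) = b≢x (Fin2-≢⇒≡ (a≢b ∘ sym) (a≢c ∘ sym))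
Fin≤2-¬Distinct₃ {suc (suc (suc _))} (s≤s (s≤s ())) _ _ _

opposite-≢ : (s : Fin 2) → opposite s ≢ s
opposite-≢ 0F ()
opposite-≢ 1F ()

≢⇒≡opposite : {s t : Fin 2} → s ≢ t → s ≡ opposite t
≢⇒≡opposite {t = t} s≢t = Fin2-≢⇒≡ s≢t (opposite-≢ t)

module _ {d : ℕ} .{{_ : NonZero d}} where

  toℕ-mod : ∀ n → toℕ (n mod d) ≡ n % d
  toℕ-mod n = toℕ-fromℕ< (m%n<n n d)

  %⇒mod : ∀ m n → m % d ≡ n % d → m mod d ≡ n mod d
  %⇒mod m n eq = toℕ-injective (trans (toℕ-mod m) (trans eq (sym (toℕ-mod n))))

  mod⇒% : ∀ {m n} → m mod d ≡ n mod d → m % d ≡ n % d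
  mod⇒% {m} {n} eq = trans (sym (toℕ-mod m)) (trans (cong toℕ eq) (toℕ-mod n))

  [m+n%d]%d≡[m+n]%d : ∀ m n → (m + n % d) % d ≡ (m + n) % d
  [m+n%d]%d≡[m+n]%d m n = begin
    (m + n % d) % d           ≡⟨ %-distribˡ-+ m (n % d) d ⟩
    (m % d + n % d % d) % d   ≡⟨ cong (λ r → (m % d + r) % d) (m%n%n≡m%n n d) ⟩
    (m % d + n % d) % d       ≡⟨ %-distribˡ-+ m n d ⟨
    (m + n) % d               ∎

-- Adding o * (d - 1) undoes adding o, modulo d.
%-cancelʳ-+ : ∀ m n o {d} .{{_ : NonZero d}} → (m + o) % d ≡ (n + o) % d → m % d ≡ n % d
%-cancelʳ-+ m n o {d@(suc p)} eq = begin
  m % d                     ≡⟨ [m+kn]%n≡m%n m o d ⟨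
  (m + o * d) % d           ≡⟨ cong (_% d) (regroup m o p) ⟩
  (o * p + (m + o)) % d     ≡⟨ [m+n%d]%d≡[m+n]%d (o * p) (m + o) ⟨
  (o * p + (m + o) % d) % d ≡⟨ cong (λ r → (o * p + r) % d) eq ⟩
  (o * p + (n + o) % d) % d ≡⟨ [m+n%d]%d≡[m+n]%d (o * p) (n + o) ⟩
  (o * p + (n + o)) % d     ≡⟨ cong (_% d) (regroup n o p) ⟨
  (n + o * d) % d           ≡⟨ [m+kn]%n≡m%n n o d ⟩
  n % d                     ∎
  where
  regroup : ∀ x y z → x + y * suc z ≡ y * z + (x + y)
  regroup = solve-∀

[a+n]%d≡[b+n]%d⇒a≡b : ∀ {a b n d} .{{_ : NonZero d}} → a < d → b < d → (a + n) % d ≡ (b + n) % d → a ≡ b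
[a+n]%d≡[b+n]%d⇒a≡b {a} {b} {n} {d} a<d b<d eq = begin
  a      ≡⟨ m<n⇒m%n≡m a<d ⟨
  a % d  ≡⟨ %-cancelʳ-+ a b n eq ⟩
  b % d  ≡⟨ m<n⇒m%n≡m b<d ⟩
  b      ∎

f[n%k]≡f[n] : ∀ {A : Set} {f : ℕ → A} {d k n} .{{_ : NonZero k}} → d ≤ k →
  (∀ e → e < d → f (k + e) ≡ f e) → n < d + k → f (n % k) ≡ f n
f[n%k]≡f[n] {f = f} {d} {k} {n} d≤k periodic n<d+k with n <? k
... | yes n<k = cong f (m<n⇒m%n≡m n<k)
... | no n≮k with e , refl ← m≤n⇒∃[o]m+o≡n (≮⇒≥ n≮k) = begin
  f ((k + e) % k) ≡⟨ cong f (%-remove-+ˡ e ∣-refl) ⟩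
  f (e % k)       ≡⟨ cong f (m<n⇒m%n≡m (≤-trans e<d d≤k)) ⟩
  f e             ≡⟨ periodic e e<d ⟨
  f (k + e)       ∎
  where
  e<d : e < d
  e<d = +-cancelʳ-< k e d (subst (_< d + k) (+-comm k e) n<d+k)

ConsecutiveDistinct : ∀ {m} → (ℕ → Fin m) → Set
ConsecutiveDistinct f = ∀ n → Distinct₃ (f n) (f (1 + n)) (f (2 + n))

mod-consecutiveDistinct : ∀ {m} .{{_ : NonZero m}} → 3 ≤ m → ConsecutiveDistinct (_mod m)
mod-consecutiveDistinct {m} m≥3 n =
  (λ ()) ∘ offsets 0<m 1<m , (λ ()) ∘ offsets 0<m m≥3 , (λ ()) ∘ offsets 1<m m≥3
  where
  0<m : 0 < m
  0<m = ≤-trans (s≤s z≤n) m≥3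
  1<m : 1 < m
  1<m = ≤-trans (s≤s (s≤s z≤n)) m≥3
  offsets : ∀ {a b} → a < m → b < m → (a + n) mod m ≡ (b + n) mod m → a ≡ b
  offsets a<m b<m = [a+n]%d≡[b+n]%d⇒a≡b a<m b<m ∘ mod⇒%

blocks : ℕ → ℕ → Fin 4
blocks zero    n                   = n mod 4
blocks (suc t) 0                   = 0F
blocks (suc t) 1                   = 1F
blocks (suc t) 2                   = 2F
blocks (suc t) (suc (suc (suc n))) = blocks t n

blocks-start : ∀ t e → e < 2 → blocks t e ≡ e mod 4
blocks-start zero    e _ = refl
blocks-start (suc t) 0 _ = refl
blocks-start (suc t) 1 _ = refl
blocks-start (suc t) (suc (suc _)) (s≤s (s≤s ()))

blocks-skip : ∀ t n → blocks t (t * 3 + n) ≡ n mod 4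
blocks-skip zero    n = refl
blocks-skip (suc t) n = blocks-skip t n

blocks-consecutiveDistinct : ∀ t → ConsecutiveDistinct (blocks t)
blocks-consecutiveDistinct zero = mod-consecutiveDistinct (s≤s (s≤s (s≤s z≤n)))
blocks-consecutiveDistinct (suc t) 0 = (λ ()) , (λ ()) , (λ ())
blocks-consecutiveDistinct (suc t) 1 =
  Distinct₃-≡ refl refl (blocks-start t 0 (s≤s z≤n)) ((λ ()) , (λ ()) , (λ ()))
blocks-consecutiveDistinct (suc t) 2 =
  Distinct₃-≡ refl (blocks-start t 0 (s≤s z≤n)) (blocks-start t 1 ≤-refl) ((λ ()) , (λ ()) , (λ ()))
blocks-consecutiveDistinct (suc t) (suc (suc (suc n))) = blocks-consecutiveDistinct t n

module ThreeColourLayers {x y : ℕ → Fin 3}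
  (x-rainbow : ∀ n → Distinct₃ (x n) (y (1 + n)) (x (2 + n)))
  (y-gap : ∀ n → y n ≢ y (2 + n)) where

  x-gap₂ : ∀ n → x n ≢ x (2 + n)
  x-gap₂ = proj₁ ∘ proj₂ ∘ x-rainbow

  -- y (1 + n) and y (3 + n) would both be the colour missing from {x n, x (2 + n)}.
  x-gap₄ : ∀ n → x n ≢ x (4 + n)
  x-gap₄ n x₀≡x₄ with x-rainbow n | x-rainbow (2 + n)
  ... | x₀≢y₁ , x₀≢x₂ , y₁≢x₂ | x₂≢y₃ , _ , y₃≢x₄ =
    y-gap (1 + n) (Fin3-≢⇒≡ x₀≢x₂ (x₀≢y₁ ∘ sym) y₁≢x₂ (λ y₃≡x₀ → y₃≢x₄ (trans y₃≡x₀ x₀≡x₄)) (x₂≢y₃ ∘ sym))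

  x-period₆ : ∀ n → x (6 + n) ≡ x n
  x-period₆ n = Fin3-≢⇒≡ (x-gap₂ (2 + n))
    (x-gap₄ (2 + n) ∘ sym) (x-gap₂ (4 + n) ∘ sym) (x-gap₂ n) (x-gap₄ n)

  x-return⇒m%3≡0 : ∀ m → x (m * 2) ≡ x 0 → m % 3 ≡ 0
  x-return⇒m%3≡0 0 _ = refl
  x-return⇒m%3≡0 1 x₂≡x₀ = contradiction (sym x₂≡x₀) (x-gap₂ 0)
  x-return⇒m%3≡0 2 x₄≡x₀ = contradiction (sym x₄≡x₀) (x-gap₄ 0)
  x-return⇒m%3≡0 (suc (suc (suc m))) x₆₊≡x₀ = x-return⇒m%3≡0 m (trans (sym (x-period₆ (m * 2))) x₆₊≡x₀)

data Side : Set where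
  before across after : Side

Distinct₃⇒separated : {A : Set} (f : Side → A) →
  Distinct₃ (f before) (f across) (f after) → ∀ σ σ′ → σ ≢ σ′ → f σ ≢ f σ′
Distinct₃⇒separated f (bef≢acr , _ , _) before across _ = bef≢acr
Distinct₃⇒separated f (_ , bef≢aft , _) before after  _ = bef≢aft
Distinct₃⇒separated f (bef≢acr , _ , _) across before _ = bef≢acr ∘ sym
Distinct₃⇒separated f (_ , _ , acr≢aft) across after  _ = acr≢aft
Distinct₃⇒separated f (_ , bef≢aft , _) after  before _ = bef≢aft ∘ sym
Distinct₃⇒separated f (_ , _ , acr≢aft) after  across _ = acr≢aft ∘ sym
Distinct₃⇒separated f _       before before σ≢σ = contradiction refl σ≢σ
Distinct₃⇒separated f _       across across σ≢σ = contradiction refl σ≢σ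
Distinct₃⇒separated f _       after  after  σ≢σ = contradiction refl σ≢σ

module PrismNeighbourhoods (k : ℕ) .{{_ : NonZero k}} where

  at : Fin 2 → ℕ → V (Prism k)
  at s n = s , n mod k

  -- The neighbours of at t (1 + n); centring at 1 + n avoids predecessors (truncated subtraction).
  neighbour : Side → Fin 2 → ℕ → V (Prism k)
  neighbour before t n = at t n
  neighbour across t n = at (opposite t) (1 + n)
  neighbour after  t n = at t (2 + n)

  toℕ-mod-suc : ∀ n → toℕ ((1 + n) mod k) ≡ suc (toℕ (n mod k)) % k
  toℕ-mod-suc n = begin
    toℕ ((1 + n) mod k)     ≡⟨ toℕ-mod (1 + n) ⟩
    (1 + n) % k             ≡⟨ [m+n%d]%d≡[m+n]%d 1 n ⟨
    suc (n % k) % k         ≡⟨ cong (λ r → suc r % k) (toℕ-mod n) ⟨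
    suc (toℕ (n mod k)) % k ∎

  suc-%-injective : ∀ {a b} → a < k → b < k → suc a % k ≡ suc b % k → a ≡ b
  suc-%-injective {a} {b} a<k b<k eq = [a+n]%d≡[b+n]%d⇒a≡b {n = 1} a<k b<k
    (subst₂ (λ a′ b′ → a′ % k ≡ b′ % k) (+-comm 1 a) (+-comm 1 b) eq)

  neighbour-adjacent : ∀ σ t n → Adj (Prism k) (neighbour σ t n) (at t (1 + n))
  neighbour-adjacent before t n = inj₁ (refl , inj₁ (toℕ-mod-suc n))
  neighbour-adjacent across t n = inj₂ (opposite-≢ t , refl)
  neighbour-adjacent after  t n = inj₁ (refl , inj₂ (toℕ-mod-suc (1 + n)))

  adjacent⇒neighbour : ∀ {v} t n → Adj (Prism k) v (at t (1 + n)) → ∃ λ σ → v ≡ neighbour σ t n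
  adjacent⇒neighbour {s , i} t n (inj₁ (refl , inj₁ i+1≡)) = before , cong (s ,_) (toℕ-injective
    (suc-%-injective (toℕ<n i) (toℕ<n (n mod k)) (trans (sym i+1≡) (toℕ-mod-suc n))))
  adjacent⇒neighbour {s , i} t n (inj₁ (refl , inj₂ i≡)) = after , cong (s ,_) (toℕ-injective
    (trans i≡ (sym (toℕ-mod-suc (1 + n)))))
  adjacent⇒neighbour t n (inj₂ (s≢t , refl)) = across , cong (_, _) (≢⇒≡opposite s≢t)

  at-surjective : ∀ w → ∃₂ λ t n → w ≡ at t (1 + n)
  at-surjective (t , j) = t , pred k + toℕ j , cong (t ,_) (toℕ-injective (sym (begin
    toℕ ((suc (pred k) + toℕ j) mod k) ≡⟨ toℕ-mod (suc (pred k) + toℕ j) ⟩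
    (suc (pred k) + toℕ j) % k         ≡⟨ cong (λ k′ → (k′ + toℕ j) % k) (suc-pred k) ⟩
    (k + toℕ j) % k                    ≡⟨ %-remove-+ˡ (toℕ j) ∣-refl ⟩
    toℕ j % k                          ≡⟨ m<n⇒m%n≡m (toℕ<n j) ⟩
    toℕ j                              ∎)))

  before≢after : 3 ≤ k → ∀ t n → at t n ≢ at t (2 + n)
  before≢after k≥3 t n =
    (λ ()) ∘ [a+n]%d≡[b+n]%d⇒a≡b {0} {2} (≤-trans (s≤s z≤n) k≥3) k≥3 ∘ mod⇒% ∘ cong proj₂

  RainbowNeighbourhoods : ∀ {m} → (V (Prism k) → Fin m) → Set
  RainbowNeighbourhoods c = ∀ t n →
    Distinct₃ (c (neighbour before t n)) (c (neighbour across t n)) (c (neighbour after t n))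

  injective⇒rainbow : ∀ {m} {c : V (Prism k) → Fin m} → 3 ≤ k →
    IsInjectiveColouring (Prism k) m c → RainbowNeighbourhoods c
  injective⇒rainbow {c = c} k≥3 injective t n =
    separated before across (opposite-≢ t ∘ sym ∘ cong proj₁) ,
    separated before after  (before≢after k≥3 t n) ,
    separated across after  (opposite-≢ t ∘ cong proj₁)
    where
    separated : ∀ σ σ′ → neighbour σ t n ≢ neighbour σ′ t n → c (neighbour σ t n) ≢ c (neighbour σ′ t n)
    separated σ σ′ v≢v′ = injective _ _ _ v≢v′ (neighbour-adjacent σ t n) (neighbour-adjacent σ′ t n)

  rainbow⇒injective : ∀ {m} {c : V (Prism k) → Fin m} →
    RainbowNeighbourhoods c → IsInjectiveColouring (Prism k) m c
  rainbow⇒injective {c = c} rainbow v v′ w v≢v′ v~w v′~w with at-surjective w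
  ... | t , n , refl with adjacent⇒neighbour t n v~w | adjacent⇒neighbour t n v′~w
  ...   | σ , refl | σ′ , refl =
    Distinct₃⇒separated (λ σ → c (neighbour σ t n)) (rainbow t n) σ σ′ (λ { refl → v≢v′ refl })

  layerColouring : ∀ {m} → (Fin 2 → ℕ → Fin m) → V (Prism k) → Fin m
  layerColouring F (s , i) = F s (toℕ i)

  layerColouring-rainbow : ∀ {m} {F : Fin 2 → ℕ → Fin m} → 2 ≤ k →
    (∀ s e → e < 2 → F s (k + e) ≡ F s e) →
    (∀ s r → r < k → Distinct₃ (F s r) (F (opposite s) (1 + r)) (F s (2 + r))) →
    RainbowNeighbourhoods (layerColouring F)
  layerColouring-rainbow {F = F} k≥2 periodic distinct t n =
    Distinct₃-≡ (reading t 0 z≤n) (reading (opposite t) 1 (s≤s z≤n)) (reading t 2 ≤-refl)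
      (distinct t (n % k) (m%n<n n k))
    where
    reading : ∀ s a → a ≤ 2 → layerColouring F (at s (a + n)) ≡ F s (a + n % k)
    reading s a a≤2 = begin
      F s (toℕ ((a + n) mod k)) ≡⟨ cong (F s) (toℕ-mod (a + n)) ⟩
      F s ((a + n) % k)         ≡⟨ cong (F s) ([m+n%d]%d≡[m+n]%d a n) ⟨
      F s ((a + n % k) % k)     ≡⟨ f[n%k]≡f[n] k≥2 (periodic s) (+-mono-≤-< a≤2 (m%n<n n k)) ⟩
      F s (a + n % k)           ∎

module PrismColourings {k : ℕ} .{{_ : NonZero k}} (k≥3 : 3 ≤ k) where
  open PrismNeighbourhoods k

  k≥2 : 2 ≤ k
  k≥2 = ≤-trans (s≤s (s≤s z≤n)) k≥3

  ¬colourable<3 : ∀ {j} → j < 3 → ¬ InjectivelyColourable (Prism k) j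
  ¬colourable<3 j<3 (c , injective) =
    Fin≤2-¬Distinct₃ (≤-pred j<3) _ _ _ (injective⇒rainbow k≥3 injective 0F 0)

  threeColourable⇒k%3≡0 : InjectivelyColourable (Prism k) 3 → k % 3 ≡ 0
  threeColourable⇒k%3≡0 (c , injective) =
    ThreeColourLayers.x-return⇒m%3≡0 (rainbow 0F) (proj₁ ∘ proj₂ ∘ rainbow 1F) k
      (cong (λ i → c (0F , i)) (%⇒mod (k * 2) 0 (trans (cong (_% k) (*-comm k 2)) ([m+kn]%n≡m%n 0 2 k))))
    where
    rainbow : RainbowNeighbourhoods c
    rainbow = injective⇒rainbow k≥3 injective

  consecutiveDistinct⇒colourable : ∀ {m} {f : ℕ → Fin m} → ConsecutiveDistinct f →
    (∀ e → e < 2 → f (k + e) ≡ f e) → InjectivelyColourable (Prism k) m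
  consecutiveDistinct⇒colourable {f = f} distinct periodic =
    layerColouring (λ _ → f) ,
    rainbow⇒injective (layerColouring-rainbow k≥2 (λ _ → periodic) (λ _ r _ → distinct r))

  k%3≡0⇒threeColourable : k % 3 ≡ 0 → InjectivelyColourable (Prism k) 3
  k%3≡0⇒threeColourable k%3≡0 = consecutiveDistinct⇒colourable (mod-consecutiveDistinct ≤-refl)
    (λ e _ → %⇒mod (k + e) e (%-remove-+ˡ e (m%n≡0⇒n∣m k 3 k%3≡0)))

  blocks-colourable : ∀ t b → k ≡ t * 3 + b * 4 → InjectivelyColourable (Prism k) 4
  blocks-colourable t b k≡ = consecutiveDistinct⇒colourable (blocks-consecutiveDistinct t) periodic
    where
    periodic : ∀ e → e < 2 → blocks t (k + e) ≡ blocks t e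
    periodic e e<2 = begin
      blocks t (k + e)               ≡⟨ cong (blocks t) (trans (cong (_+ e) k≡) (+-assoc (t * 3) (b * 4) e)) ⟩
      blocks t (t * 3 + (b * 4 + e)) ≡⟨ blocks-skip t (b * 4 + e) ⟩
      (b * 4 + e) mod 4              ≡⟨ %⇒mod (b * 4 + e) e (%-remove-+ˡ e (n∣m*n b)) ⟩
      e mod 4                        ≡⟨ blocks-start t e e<2 ⟨
      blocks t e                     ∎

  ¬colourable<4 : k % 3 ≢ 0 → ∀ j → j < 4 → ¬ InjectivelyColourable (Prism k) j
  ¬colourable<4 k%3≢0 j j<4 with m≤n⇒m<n∨m≡n (≤-pred j<4)
  ... | inj₁ j<3  = ¬colourable<3 j<3
  ... | inj₂ refl = k%3≢0 ∘ threeColourable⇒k%3≡0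

open PrismColourings

pentagon : Fin 2 → ℕ → Fin 4
pentagon s  (suc (suc (suc (suc (suc n))))) = pentagon s n
pentagon 0F 0 = 0F
pentagon 0F 1 = 1F
pentagon 0F 2 = 1F
pentagon 0F 3 = 2F
pentagon 0F 4 = 0F
pentagon 1F 0 = 2F
pentagon 1F 1 = 2F
pentagon 1F 2 = 0F
pentagon 1F 3 = 3F
pentagon 1F 4 = 1F

pentagon-distinct : ∀ s r → r < 5 → Distinct₃ (pentagon s r) (pentagon (opposite s) (1 + r)) (pentagon s (2 + r))
pentagon-distinct 0F 0 _ = (λ ()) , (λ ()) , (λ ())
pentagon-distinct 0F 1 _ = (λ ()) , (λ ()) , (λ ())
pentagon-distinct 0F 2 _ = (λ ()) , (λ ()) , (λ ())
pentagon-distinct 0F 3 _ = (λ ()) , (λ ()) , (λ ())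
pentagon-distinct 0F 4 _ = (λ ()) , (λ ()) , (λ ())
pentagon-distinct 1F 0 _ = (λ ()) , (λ ()) , (λ ())
pentagon-distinct 1F 1 _ = (λ ()) , (λ ()) , (λ ())
pentagon-distinct 1F 2 _ = (λ ()) , (λ ()) , (λ ())
pentagon-distinct 1F 3 _ = (λ ()) , (λ ()) , (λ ())
pentagon-distinct 1F 4 _ = (λ ()) , (λ ()) , (λ ())
pentagon-distinct _ (suc (suc (suc (suc (suc _))))) (s≤s (s≤s (s≤s (s≤s (s≤s ())))))

pentagon-colourable : InjectivelyColourable (Prism 5) 4
pentagon-colourable = layerColouring pentagon ,
  rainbow⇒injective (layerColouring-rainbow (s≤s (s≤s z≤n)) (λ _ _ _ → refl) pentagon-distinct)
  where open PrismNeighbourhoods 5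

fourColourable-by-residue : ∀ {k} .{{_ : NonZero k}} → 3 ≤ k → ∀ r q → r < 3 → r ≢ 0 → k ≡ r + q * 3 →
  InjectivelyColourable (Prism k) 4
fourColourable-by-residue _   0 _ _ r≢0 _ = contradiction refl r≢0
fourColourable-by-residue k≥3 1 0 _ _ refl = contradiction k≥3 λ { (s≤s ()) }
fourColourable-by-residue k≥3 1 (suc t) _ _ refl = blocks-colourable k≥3 t 1 (+-comm 4 (t * 3))
fourColourable-by-residue k≥3 2 0 _ _ refl = contradiction k≥3 λ { (s≤s (s≤s ())) }
fourColourable-by-residue _   2 1 _ _ refl = pentagon-colourable
fourColourable-by-residue k≥3 2 (suc (suc t)) _ _ refl = blocks-colourable k≥3 t 2 (+-comm 8 (t * 3))
fourColourable-by-residue _ (suc (suc (suc _))) _ (s≤s (s≤s (s≤s ()))) _ _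

k%3≢0⇒fourColourable : ∀ {k} .{{_ : NonZero k}} → 3 ≤ k → k % 3 ≢ 0 → InjectivelyColourable (Prism k) 4
k%3≢0⇒fourColourable {k} k≥3 k%3≢0 =
  fourColourable-by-residue k≥3 (k % 3) (k / 3) (m%n<n k 3) k%3≢0 (m≡m%n+[m/n]*n k 3)

theorem14 : (k : ℕ) → .{{_ : NonZero k}} → 3 ≤ k →
    (InjChromaticNumber (Prism k) 4 ⇔ (¬ (k % 3 ≡ 0)))
theorem14 k k≥3 = mk⇔
  (λ (_ , minimal) k%3≡0 → minimal 3 ≤-refl (k%3≡0⇒threeColourable k≥3 k%3≡0))
  (λ k%3≢0 → k%3≢0⇒fourColourable k≥3 k%3≢0 , ¬colourable<4 k≥3 k%3≢0)
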